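{- Let $m,n\in\mathbb{N}$ and let $\mathbf{x}=(x_1,\ldots,x_m)\in[n+1]^m$ be nondecreasing. Then \[\mathrm{dft}(\mathbf{x})=\max\big(\delta(\mathbf{x})_1,\delta(\mathbf{x})_2,\ldots,\delta(\mathbf{x})_m,0\big),\] where $\delta(\mathbf{x})_i=x_i-i+(m-n)$.
   Context: Cars $1,\ldots,m$ arrive in order at an infinitely long street with spots $1,2,3,\ldots$; car $i$ goes to spot $x_i$ and parks in the first empty spot numbered $\ge x_i$. The defect $\mathrm{dft}(\mathbf{x})$ is the number of cars that park in a spot numbered greater than $n$. The sequence $\delta(\mathbf{x})=(x_1-1+(m-n),\ldots,x_m-m+(m-n))$ is called the defect sequence. -}

module Defs where

open import Data.Nat using (ℕ; zero; suc; _+_; _≤_; _<_; _≤ᵇ_)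
open import Data.Nat.Properties using (_≟_)
open import Data.Bool using (Bool; true; false; if_then_else_)
open import Data.List using (List; []; _∷_; length; _++_; [_]; filter; foldr; map)
open import Data.List.Membership.DecPropositional _≟_ using (_∈?_)
open import Data.Vec using (Vec; toList; lookup)
open import Data.Fin using (Fin; toℕ)
open import Data.Integer as ℤ using (ℤ; +_; _-_; _⊔_)
open import Relation.Nullary.Decidable using (does; ⌊_⌋)
open import Relation.Unary using (Decidable)

-- Searches x, x+1, ..., using 'fuel' steps; with fuel = length occ the
-- search always finds a free spot (pigeonhole), the final fallback
-- being spot x + fuel, which is then necessarily free.
firstFree : List ℕ → ℕ → ℕ → ℕ
firstFree occ x zero = x
firstFree occ x (suc fuel) = if does (x ∈? occ) then firstFree occ (suc x) fuel else x

parkStep : List ℕ → List ℕ → List ℕ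
parkStep occ [] = occ
parkStep occ (x ∷ xs) = parkStep (occ ++ [ firstFree occ x (length occ) ]) xs

parkingOutcome : List ℕ → List ℕ
parkingOutcome xs = parkStep [] xs

dft : ∀ {m} → ℕ → Vec ℕ m → ℕ
dft n x = length (filter (λ s → n Data.Nat.<? s) (parkingOutcome (toList x)))

δ : ∀ {m} → ℕ → Vec ℕ m → Fin m → ℤ
δ {m} n x i = ((+ lookup x i) - (+ suc (toℕ i))) ℤ.+ ((+ m) - (+ n))

maxδ0 : ∀ {m} → ℕ → Vec ℕ m → ℤ
maxδ0 {m} n x = foldr _⊔_ (+ 0) (map (δ n x) (Data.List.allFin m))

InRange : ∀ {m} → ℕ → Vec ℕ m → Set
InRange n x = ∀ i → 1 ≤ lookup x i × lookup x i ≤ suc n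
  where open import Data.Product using (_×_)

Nondecreasing : ∀ {m} → Vec ℕ m → Set
Nondecreasing {m} x = ∀ (i j : Fin m) → toℕ i ≤ toℕ j → lookup x i ≤ lookup x j

{-# OPTIONS --safe #-}
-- With nondecreasing arrivals every spot from x_i up to the last car parked is
-- already taken, so car i parks at p_i = max (x_i, p_{i-1} + 1); unrolling,
-- p_m = max_i (x_i + m - i) = n + max_i δ_i (for m ≥ 1).  As x_i ≤ n + 1, once a car
-- parks beyond n every later car takes the next spot, so the cars beyond n
-- fill exactly n+1, ..., p_m and the defect is p_m ∸ n = max (δ_1, ..., δ_m, 0).
module Submission where

open import Defs
open import Data.Nat using (ℕ)
open import Data.Vec using (Vec)
open import Data.Integer using (+_)
open import Relation.Binary.PropositionalEquality using (_≡_)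

open import Data.Nat using (zero; suc; _+_; _∸_; _⊔_; _≤_; _<_; z≤n; s≤s; _<?_)
open import Data.Nat.Properties
open import Data.Integer as ℤ using (_-_; _⊖_)
import Data.Integer.Properties as ℤP
open import Data.Integer.Tactic.RingSolver using (solve-∀)
open import Data.List using (List; []; _∷_; [_]; _++_; length; filter; foldr; map; tabulate)
open import Data.List.Properties using (++-assoc; ++-identityʳ; length-++; filter-accept; filter-reject; map-tabulate; tabulate-cong)
open import Data.List.Membership.Propositional using (_∈_)
open import Data.List.Membership.Propositional.Properties using (∈-++⁺ˡ; ∈-++⁺ʳ; ∈-++⁻)
open import Data.List.Membership.DecPropositional _≟_ using (_∈?_)
open import Data.List.Relation.Unary.All using (All; []; _∷_)
open import Data.List.Relation.Unary.Any using (here)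
open import Data.List.Relation.Unary.Linked using (Linked; []; [-]; _∷_)
open import Data.Vec using ([]; _∷_; toList; lookup)
open import Data.Vec.Properties using (length-toList)
open import Data.Fin as Fin using (toℕ)
open import Data.Product using (proj₂)
open import Data.Sum using (inj₁; inj₂)
open import Function using (_∘_; id)
open import Relation.Nullary using (yes; no)
open import Relation.Binary.PropositionalEquality using (refl; sym; trans; cong; cong₂; subst; module ≡-Reasoning)

-- The spots taken by sorted arrivals, t being the spot after the last car parked.
spotsFrom : ℕ → List ℕ → List ℕ
spotsFrom t []       = []
spotsFrom t (x ∷ xs) = x ⊔ t ∷ spotsFrom (suc (x ⊔ t)) xs

frontAfter : ℕ → List ℕ → ℕ
frontAfter t []       = t
frontAfter t (x ∷ xs) = frontAfter (suc (x ⊔ t)) xs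

record Packed (occ : List ℕ) (lo t : ℕ) : Set where
  field
    below  : ∀ {y} → y ∈ occ → y < t
    covers : ∀ {y} → lo ≤ y → y < t → y ∈ occ
    fits   : t ≤ lo + length occ  -- the fuel length occ of firstFree suffices

Packed-[] : Packed [] 0 0
Packed-[] = record { below = λ () ; covers = λ _ () ; fits = z≤n }

Packed-raise : ∀ {occ lo x t} → lo ≤ x → Packed occ lo t → Packed occ x t
Packed-raise {occ} lo≤x p = record
  { below  = below
  ; covers = covers ∘ ≤-trans lo≤x
  ; fits   = ≤-trans fits (+-monoˡ-≤ (length occ) lo≤x)
  }
  where open Packed p

firstFree-packed : ∀ {occ x t} fuel → Packed occ x t → t ≤ x + fuel →
                   firstFree occ x fuel ≡ x ⊔ t
firstFree-packed {x = x} {t} zero p t≤x+0 =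
  sym (m≥n⇒m⊔n≡m (subst (t ≤_) (+-identityʳ x) t≤x+0))
firstFree-packed {occ} {x} {t} (suc fuel) p t≤ with x ∈? occ
... | yes x∈occ = begin
  firstFree occ (suc x) fuel  ≡⟨ firstFree-packed fuel (Packed-raise (n≤1+n x) p)
                                   (subst (t ≤_) (+-suc x fuel) t≤) ⟩
  suc x ⊔ t                   ≡⟨ m≤n⇒m⊔n≡n x<t ⟩
  t                           ≡⟨ m≤n⇒m⊔n≡n (<⇒≤ x<t) ⟨
  x ⊔ t                       ∎
  where
  open ≡-Reasoning
  x<t = Packed.below p x∈occ
... | no x∉occ = sym (m≥n⇒m⊔n≡m (≮⇒≥ (x∉occ ∘ Packed.covers p ≤-refl)))

Packed-park : ∀ {occ x t} → Packed occ x t → Packed (occ ++ [ x ⊔ t ]) x (suc (x ⊔ t))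
Packed-park {occ} {x} {t} p = record { below = below′ ; covers = covers′ ; fits = fits′ }
  where
  open Packed p
  below′ : ∀ {y} → y ∈ occ ++ [ x ⊔ t ] → y < suc (x ⊔ t)
  below′ y∈ with ∈-++⁻ occ y∈
  ... | inj₁ y∈occ       = m≤n⇒m≤1+n (≤-trans (below y∈occ) (m≤n⊔m x t))
  ... | inj₂ (here refl) = ≤-refl
  covers′ : ∀ {y} → x ≤ y → y < suc (x ⊔ t) → y ∈ occ ++ [ x ⊔ t ]
  covers′ {y} x≤y y<1+x⊔t with y <? t
  ... | yes y<t = ∈-++⁺ˡ (covers x≤y y<t)
  ... | no y≮t  = ∈-++⁺ʳ occ (here (≤-antisym (≤-pred y<1+x⊔t) (⊔-lub x≤y (≮⇒≥ y≮t))))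
  fits′ : suc (x ⊔ t) ≤ x + length (occ ++ [ x ⊔ t ])
  fits′ = begin
    suc (x ⊔ t)                      ≤⟨ s≤s (⊔-lub (m≤m+n x (length occ)) fits) ⟩
    suc (x + length occ)             ≡⟨ +-suc x (length occ) ⟨
    x + suc (length occ)             ≡⟨ cong (_+_ x) (+-comm 1 (length occ)) ⟩
    x + (length occ + 1)             ≡⟨ cong (_+_ x) (length-++ occ) ⟨
    x + length (occ ++ [ x ⊔ t ])    ∎
    where open ≤-Reasoning

parkStep-sorted : ∀ {occ lo t xs} → Packed occ lo t → Linked _≤_ (lo ∷ xs) →
                  parkStep occ xs ≡ occ ++ spotsFrom t xs
parkStep-sorted {occ} {xs = []} p _ = sym (++-identityʳ occ)
parkStep-sorted {occ} {t = t} {x ∷ xs} p (lo≤x ∷ sorted) = begin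
  parkStep (occ ++ [ firstFree occ x (length occ) ]) xs
    ≡⟨ cong (λ s → parkStep (occ ++ [ s ]) xs) (firstFree-packed (length occ) p′ (Packed.fits p′)) ⟩
  parkStep (occ ++ [ x ⊔ t ]) xs
    ≡⟨ parkStep-sorted (Packed-park p′) sorted ⟩
  (occ ++ [ x ⊔ t ]) ++ spotsFrom (suc (x ⊔ t)) xs
    ≡⟨ ++-assoc occ [ x ⊔ t ] _ ⟩
  occ ++ spotsFrom t (x ∷ xs)
    ∎
  where
  open ≡-Reasoning
  p′ = Packed-raise lo≤x p

parkingOutcome-sorted : ∀ {xs} → Linked _≤_ xs → parkingOutcome xs ≡ spotsFrom 0 xs
parkingOutcome-sorted sorted = parkStep-sorted Packed-[] (0≤ sorted)
  where
  0≤ : ∀ {xs} → Linked _≤_ xs → Linked _≤_ (0 ∷ xs)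
  0≤ []         = [-]
  0≤ [-]        = z≤n ∷ [-]
  0≤ l@(_ ∷ _)  = z≤n ∷ l

countAbove : ℕ → List ℕ → ℕ
countAbove n ys = length (filter (n <?_) ys)

countAbove-spotsFrom : ∀ n t {xs} → All (_≤ suc n) xs →
                       countAbove n (spotsFrom t xs) + (t ∸ suc n) ≡ frontAfter t xs ∸ suc n
countAbove-spotsFrom n t [] = refl
countAbove-spotsFrom n t {x ∷ xs} (x≤1+n ∷ xs≤1+n) with n <? x ⊔ t
... | yes n<x⊔t = begin
  length (filter (n <?_) (x ⊔ t ∷ rest)) + (t ∸ suc n)
    ≡⟨ cong (λ ys → length ys + (t ∸ suc n)) (filter-accept (n <?_) n<x⊔t) ⟩
  suc (countAbove n rest) + (t ∸ suc n)
    ≡⟨ +-suc (countAbove n rest) (t ∸ suc n) ⟨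
  countAbove n rest + suc (t ∸ suc n)
    ≡⟨ cong (_+_ (countAbove n rest)) overflowing ⟩
  countAbove n rest + (x ⊔ t ∸ n)
    ≡⟨ countAbove-spotsFrom n (suc (x ⊔ t)) xs≤1+n ⟩
  frontAfter (suc (x ⊔ t)) xs ∸ suc n
    ∎
  where
  open ≡-Reasoning
  rest = spotsFrom (suc (x ⊔ t)) xs
  overflowing : suc (t ∸ suc n) ≡ x ⊔ t ∸ n
  overflowing = sym (begin
    x ⊔ t ∸ n                          ≡⟨ +-∸-assoc 1 n<x⊔t ⟩
    suc (x ⊔ t ∸ suc n)                ≡⟨ cong suc (∸-distribʳ-⊔ (suc n) x t) ⟩
    suc ((x ∸ suc n) ⊔ (t ∸ suc n))    ≡⟨ cong (λ k → suc (k ⊔ (t ∸ suc n))) (m≤n⇒m∸n≡0 x≤1+n) ⟩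
    suc (t ∸ suc n)                    ∎)
... | no n≮x⊔t = begin
  length (filter (n <?_) (x ⊔ t ∷ rest)) + (t ∸ suc n)
    ≡⟨ cong (λ ys → length ys + (t ∸ suc n)) (filter-reject (n <?_) n≮x⊔t) ⟩
  countAbove n rest + (t ∸ suc n)
    ≡⟨ cong (_+_ (countAbove n rest)) fitting ⟩
  countAbove n rest + (x ⊔ t ∸ n)
    ≡⟨ countAbove-spotsFrom n (suc (x ⊔ t)) xs≤1+n ⟩
  frontAfter (suc (x ⊔ t)) xs ∸ suc n
    ∎
  where
  open ≡-Reasoning
  rest = spotsFrom (suc (x ⊔ t)) xs
  x⊔t≤n = ≮⇒≥ n≮x⊔t
  fitting : t ∸ suc n ≡ x ⊔ t ∸ n
  fitting = trans (m≤n⇒m∸n≡0 (m≤n⇒m≤1+n (≤-trans (m≤n⊔m x t) x⊔t≤n)))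
                  (sym (m≤n⇒m∸n≡0 x⊔t≤n))

-- reach xs = max_i (x_i + m - i + 1) = n + 1 + max_i δ_i.
reach : List ℕ → ℕ
reach []       = 0
reach (x ∷ xs) = (x + length (x ∷ xs)) ⊔ reach xs

frontAfter-reach : ∀ t xs → frontAfter t xs ≡ (t + length xs) ⊔ reach xs
frontAfter-reach t [] = sym (trans (⊔-identityʳ (t + 0)) (+-identityʳ t))
frontAfter-reach t (x ∷ xs) = begin
  frontAfter (suc (x ⊔ t)) xs                   ≡⟨ frontAfter-reach (suc (x ⊔ t)) xs ⟩
  (suc (x ⊔ t) + k) ⊔ reach xs                  ≡⟨ cong (_⊔ reach xs) (+-suc (x ⊔ t) k) ⟨
  (x ⊔ t + suc k) ⊔ reach xs                    ≡⟨ cong (_⊔ reach xs) (+-distribʳ-⊔ (suc k) x t) ⟩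
  (x + suc k) ⊔ (t + suc k) ⊔ reach xs          ≡⟨ cong (_⊔ reach xs) (⊔-comm (x + suc k) (t + suc k)) ⟩
  (t + suc k) ⊔ (x + suc k) ⊔ reach xs          ≡⟨ ⊔-assoc (t + suc k) (x + suc k) (reach xs) ⟩
  (t + suc k) ⊔ ((x + suc k) ⊔ reach xs)        ∎
  where
  open ≡-Reasoning
  k = length xs

length≤reach : ∀ xs → length xs ≤ reach xs
length≤reach []       = z≤n
length≤reach (x ∷ xs) = ≤-trans (m≤n+m (length (x ∷ xs)) x) (m≤m⊔n _ (reach xs))

frontAfter-0 : ∀ xs → frontAfter 0 xs ≡ reach xs
frontAfter-0 xs = trans (frontAfter-reach 0 xs) (m≤n⇒m⊔n≡n (length≤reach xs))

+[m∸n]≡[m-n]⊔0 : ∀ m n → + (m ∸ n) ≡ (+ m - + n) ℤ.⊔ + 0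
+[m∸n]≡[m-n]⊔0 m n = trans byCases (cong (ℤ._⊔ + 0) (sym (ℤP.m-n≡m⊖n m n)))
  where
  byCases : + (m ∸ n) ≡ (m ⊖ n) ℤ.⊔ + 0
  byCases with ≤-total n m
  ... | inj₁ n≤m = trans (cong +_ (sym (⊔-identityʳ (m ∸ n))))
                         (cong (ℤ._⊔ + 0) (sym (ℤP.⊖-≥ n≤m)))
  ... | inj₂ m≤n = trans (cong +_ (m≤n⇒m∸n≡0 m≤n))
                         (trans (sym (ℤP.i≤j⇒i⊔j≡j ℤP.neg-≤-pos))
                                (cong (ℤ._⊔ + 0) (sym (ℤP.⊖-≤ m≤n))))

[m-o]⊔[n∸o]≡[m⊔n]∸o : ∀ m n o → (+ m - + o) ℤ.⊔ + (n ∸ o) ≡ + (m ⊔ n ∸ o)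
[m-o]⊔[n∸o]≡[m⊔n]∸o m n o = begin
  (+ m - + o) ℤ.⊔ + (n ∸ o)             ≡⟨ ℤP.⊔-assoc (+ m - + o) (+ 0) (+ (n ∸ o)) ⟨
  (+ m - + o) ℤ.⊔ + 0 ℤ.⊔ + (n ∸ o)     ≡⟨ cong (ℤ._⊔ + (n ∸ o)) (+[m∸n]≡[m-n]⊔0 m o) ⟨
  + (m ∸ o) ℤ.⊔ + (n ∸ o)               ≡⟨ cong +_ (∸-distribʳ-⊔ o m n) ⟨
  + (m ⊔ n ∸ o)                         ∎
  where open ≡-Reasoning

-- + (1 + k) is definitionally + 1 ℤ.+ + k, so the ring solver applies directly.
δ-head : ∀ {k} n x (v : Vec ℕ k) → δ n (x ∷ v) Fin.zero ≡ + (x + suc k) - + suc n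
δ-head {k} n x v = shift (+ x) (+ k) (+ n)
  where
  shift : ∀ a k n → (a - + 1) ℤ.+ ((+ 1 ℤ.+ k) - n) ≡ (a ℤ.+ (+ 1 ℤ.+ k)) - (+ 1 ℤ.+ n)
  shift = solve-∀

δ-tail : ∀ {k} n x (v : Vec ℕ k) i → δ n (x ∷ v) (Fin.suc i) ≡ δ n v i
δ-tail {k} n x v i = shift (+ lookup v i) (+ toℕ i) (+ k) (+ n)
  where
  shift : ∀ a i k n → (a - (+ 1 ℤ.+ (+ 1 ℤ.+ i))) ℤ.+ ((+ 1 ℤ.+ k) - n) ≡ (a - (+ 1 ℤ.+ i)) ℤ.+ (k - n)
  shift = solve-∀

maxδ0-∷ : ∀ {k} n x (v : Vec ℕ k) → maxδ0 n (x ∷ v) ≡ (+ (x + suc k) - + suc n) ℤ.⊔ maxδ0 n v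
maxδ0-∷ n x v = cong₂ ℤ._⊔_ (δ-head n x v) (cong (foldr ℤ._⊔_ (+ 0)) (begin
  map (δ n (x ∷ v)) (tabulate Fin.suc)   ≡⟨ map-tabulate Fin.suc (δ n (x ∷ v)) ⟩
  tabulate (δ n (x ∷ v) ∘ Fin.suc)       ≡⟨ tabulate-cong (δ-tail n x v) ⟩
  tabulate (δ n v)                       ≡⟨ map-tabulate id (δ n v) ⟨
  map (δ n v) (tabulate id)              ∎))
  where open ≡-Reasoning

maxδ0≡+[reach∸1+n] : ∀ {m} n (v : Vec ℕ m) → maxδ0 n v ≡ + (reach (toList v) ∸ suc n)
maxδ0≡+[reach∸1+n] n [] = refl
maxδ0≡+[reach∸1+n] {suc k} n (x ∷ v) = begin
  maxδ0 n (x ∷ v)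
    ≡⟨ maxδ0-∷ n x v ⟩
  (+ (x + suc k) - + suc n) ℤ.⊔ maxδ0 n v
    ≡⟨ cong (_ ℤ.⊔_) (maxδ0≡+[reach∸1+n] n v) ⟩
  (+ (x + suc k) - + suc n) ℤ.⊔ + (reach (toList v) ∸ suc n)
    ≡⟨ [m-o]⊔[n∸o]≡[m⊔n]∸o (x + suc k) (reach (toList v)) (suc n) ⟩
  + ((x + suc k) ⊔ reach (toList v) ∸ suc n)
    ≡⟨ cong (λ l → + ((x + suc l) ⊔ reach (toList v) ∸ suc n)) (length-toList v) ⟨
  + (reach (toList (x ∷ v)) ∸ suc n)
    ∎
  where open ≡-Reasoning

Nondecreasing⇒Linked : ∀ {m} (v : Vec ℕ m) → Nondecreasing v → Linked _≤_ (toList v)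
Nondecreasing⇒Linked []            _  = []
Nondecreasing⇒Linked (x ∷ [])      _  = [-]
Nondecreasing⇒Linked (x ∷ y ∷ v)   nd = nd Fin.zero (Fin.suc Fin.zero) z≤n
  ∷ Nondecreasing⇒Linked (y ∷ v) (λ i j i≤j → nd (Fin.suc i) (Fin.suc j) (s≤s i≤j))

InRange⇒All : ∀ {m} n (v : Vec ℕ m) → InRange n v → All (_≤ suc n) (toList v)
InRange⇒All n []      _       = []
InRange⇒All n (x ∷ v) inRange = proj₂ (inRange Fin.zero) ∷ InRange⇒All n v (inRange ∘ Fin.suc)

lemma2p9 : (m n : ℕ) (x : Vec ℕ m) → InRange n x → Nondecreasing x →
    + dft n x ≡ maxδ0 n x
lemma2p9 m n x inRange nondecreasing = begin
  + countAbove n (parkingOutcome xs)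
    ≡⟨ cong (λ ys → + countAbove n ys) (parkingOutcome-sorted (Nondecreasing⇒Linked x nondecreasing)) ⟩
  + countAbove n (spotsFrom 0 xs)
    ≡⟨ cong +_ (+-identityʳ (countAbove n (spotsFrom 0 xs))) ⟨
  + (countAbove n (spotsFrom 0 xs) + 0)
    ≡⟨ cong +_ (countAbove-spotsFrom n 0 (InRange⇒All n x inRange)) ⟩
  + (frontAfter 0 xs ∸ suc n)
    ≡⟨ cong (λ k → + (k ∸ suc n)) (frontAfter-0 xs) ⟩
  + (reach xs ∸ suc n)
    ≡⟨ maxδ0≡+[reach∸1+n] n x ⟨
  maxδ0 n x
    ∎
  where
  open ≡-Reasoning
  xs = toList x
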